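{- Let $G=(U\sqcup V,E)$ be a bipartite graph with a perfect matching, integer weight function $w:E\to\mathbb{Z}$, optimal prices $P$, and a subset $E_p\subseteq E$. The procedure that constructs $G_{cs}(P)$, defines $w_p:E_{cs}(P)\to\{0,1\}$ by $w_p(e)=0$ for $e\in E_p$ and $w_p(e)=1$ otherwise, and returns a minimum weight perfect matching $M$ of $\{G_{cs}(P),w_p\}$, returns a minimum weight perfect matching of $\{G,w\}$ which maximizes $|M\cap E_p|$ among all minimum weight perfect matchings of $\{G,w\}$.
   Context: The dual assignment program: maximize $\sum_{u\in U}\pi(u)+\sum_{v\in V}p(v)$ over $\pi:U\to\mathbb{R}$, $p:V\to\mathbb{R}$ subject to $\pi(u)+p(v)\le w(uv)$ for all $uv\in E$; optimal prices are an optimal solution $P=(\pi,p)$. $G_{cs}(P)=(U\sqcup V,E_{cs}(P))$ with $E_{cs}(P)=\{uv\in E:\pi(u)+p(v)=w(uv)\}$.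
   Formalization: The prices $P=(\pi,p)$ and the dual assignment program are taken over the rationals rather than the reals. -}

module Defs where

open import Data.Nat using (ℕ; zero; suc)
open import Data.Fin using (Fin; zero; suc)
open import Data.Bool using (Bool; true; false; _∧_; if_then_else_; not)
open import Data.Integer as ℤ using (ℤ; +_)
open import Data.Rational as ℚ using (ℚ; _/_)
open import Data.Product using (Σ; _×_; _,_; ∃)
open import Relation.Nullary.Decidable using (⌊_⌋)
open import Relation.Binary.PropositionalEquality using (_≡_)

Σℤ : (n : ℕ) → (Fin n → ℤ) → ℤ
Σℤ zero    f = + 0
Σℤ (suc n) f = f zero ℤ.+ Σℤ n (λ i → f (suc i))

Σℚ : (n : ℕ) → (Fin n → ℚ) → ℚ
Σℚ zero    f = ℚ.0ℚ
Σℚ (suc n) f = f zero ℚ.+ Σℚ n (λ i → f (suc i))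

Σℕ : (n : ℕ) → (Fin n → ℕ) → ℕ
Σℕ zero    f = 0
Σℕ (suc n) f = f zero Data.Nat.+ Σℕ n (λ i → f (suc i))
  where import Data.Nat

-- Bipartite graphs G = (U ⊔ V, E) with U = Fin m, V = Fin n.
-- An edge set (or any subset of U × V) is a Boolean relation.

EdgeSet : ℕ → ℕ → Set
EdgeSet m n = Fin m → Fin n → Bool

_⊆E_ : ∀ {m n} → EdgeSet m n → EdgeSet m n → Set
_⊆E_ {m} {n} A B = ∀ (u : Fin m) (v : Fin n) → A u v ≡ true → B u v ≡ true

-- Weight functions (only their values on edges matter)
Weight : ℕ → ℕ → Set
Weight m n = Fin m → Fin n → ℤ

degU : ∀ {m n} → EdgeSet m n → Fin m → ℕ
degU {m} {n} M u = Σℕ n (λ v → if M u v then 1 else 0)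

degV : ∀ {m n} → EdgeSet m n → Fin n → ℕ
degV {m} {n} M v = Σℕ m (λ u → if M u v then 1 else 0)

IsPerfectMatching : ∀ {m n} → EdgeSet m n → EdgeSet m n → Set
IsPerfectMatching {m} {n} E M =
  (M ⊆E E) × (∀ u → degU M u ≡ 1) × (∀ v → degV M v ≡ 1)

weightOf : ∀ {m n} → Weight m n → EdgeSet m n → ℤ
weightOf {m} {n} w M = Σℤ m (λ u → Σℤ n (λ v → if M u v then w u v else + 0))

IsMinWeightPM : ∀ {m n} → EdgeSet m n → Weight m n → EdgeSet m n → Set
IsMinWeightPM E w M =
  IsPerfectMatching E M ×
  (∀ M′ → IsPerfectMatching E M′ → weightOf w M ℤ.≤ weightOf w M′)

card∩ : ∀ {m n} → EdgeSet m n → EdgeSet m n → ℕ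
card∩ {m} {n} A B = Σℕ m (λ u → Σℕ n (λ v → if A u v ∧ B u v then 1 else 0))

toℚ : ℤ → ℚ
toℚ z = z / 1

record Prices (m n : ℕ) : Set where
  constructor prices
  field
    π : Fin m → ℚ
    p : Fin n → ℚ
open Prices public

Feasible : ∀ {m n} → EdgeSet m n → Weight m n → Prices m n → Set
Feasible E w P = ∀ u v → E u v ≡ true → π P u ℚ.+ p P v ℚ.≤ toℚ (w u v)

dualValue : ∀ {m n} → Prices m n → ℚ
dualValue {m} {n} P = Σℚ m (π P) ℚ.+ Σℚ n (p P)

IsOptimalPrices : ∀ {m n} → EdgeSet m n → Weight m n → Prices m n → Set
IsOptimalPrices E w P =
  Feasible E w P × (∀ P′ → Feasible E w P′ → dualValue P′ ℚ.≤ dualValue P)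

Ecs : ∀ {m n} → EdgeSet m n → Weight m n → Prices m n → EdgeSet m n
Ecs E w P u v = E u v ∧ ⌊ π P u ℚ.+ p P v ℚ.≟ toℚ (w u v) ⌋

wp : ∀ {m n} → EdgeSet m n → Weight m n
wp Ep u v = if Ep u v then + 0 else + 1

module Submission where

-- Everything follows from linear programming duality for the assignment problem.
-- Weak duality: for feasible prices P and a perfect matching M of G, the dual value of P is at
-- most w(M), with equality exactly when M uses only tight edges, i.e. M ⊆ E_cs(P).
-- Strong duality (Egerváry): the Hungarian method finds feasible integral prices whose tight
-- subgraph has a perfect matching; while there is none, Hall's theorem yields a set S ⊆ U with
-- |N(S)| < |S| in the tight subgraph, and shifting the prices on S and N(S) by one raises the dual
-- value by at least one, which weak duality bounds by the weight of a fixed perfect matching.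
-- Hence, P being optimal, the minimum weight perfect matchings of {G, w} are exactly the perfect
-- matchings of G_cs(P). On those, w_p(M) = n − |M ∩ E_p|, so minimising w_p maximises
-- |M ∩ E_p|; a w_p-minimiser exists by Egerváry's theorem applied to {G_cs(P), w_p}.

open import Defs
import Algebra.Properties.CommutativeMonoid.Sum as FinSum
open import Data.Bool using (Bool; true; false; _∧_; not; if_then_else_)
import Data.Bool.Properties as Bool
open import Data.Empty using (⊥-elim)
open import Data.Fin using (Fin; zero; suc)
open import Data.Fin.Properties using (_≟_; suc-injective; any?)
open import Data.Fin.Subset
  using (Subset; inside; outside; _∈_; _∉_; _⊆_; _⊂_; _∪_; _∩_; _─_; _-_; ∣_∣; ⁅_⁆; ⊤; Nonempty; Empty)
open import Data.Fin.Subset.Properties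
open import Data.Fin.Subset.Induction using (⊂-wellFounded)
open import Data.Integer as ℤ using (ℤ; +_)
import Data.Integer.Properties as ℤP
open import Data.Integer.Tactic.RingSolver using (solve-∀)
open import Data.Nat as ℕ using (ℕ; zero; suc; _≤_; _<_; z≤n)
import Data.Nat.Coprimality as Coprime
import Data.Nat.Properties as ℕP
open import Data.Product using (_×_; _,_; ∃; ∃₂; proj₁; proj₂)
open import Data.Rational as ℚ using (ℚ; mkℚ; 0ℚ)
import Data.Rational.Properties as ℚP
open import Algebra.Properties.Monoid.Mult ℚP.+-0-monoid using () renaming (_×_ to _×ℚ_)
open import Data.Sum as Sum using (_⊎_; inj₁; inj₂)
open import Data.Vec using (_∷_; []; tabulate; lookup; here; there)
open import Data.Vec.Properties using (lookup∘tabulate; lookup⇒[]=; []=⇒lookup)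
open import Function using (_∘_; Injective)
open import Induction.WellFounded using (Acc; acc)
open import Relation.Binary.PropositionalEquality
open import Relation.Nullary using (¬_; Dec; yes; no; _×-dec_)
open import Relation.Nullary.Decidable using (⌊_⌋; ⌊⌋-map′)

⌊⌋-true : ∀ {A : Set} (a? : Dec A) → A → ⌊ a? ⌋ ≡ true
⌊⌋-true (yes _) _ = refl
⌊⌋-true (no ¬a) a = ⊥-elim (¬a a)

⌊⌋-true⁻ : ∀ {A : Set} (a? : Dec A) → ⌊ a? ⌋ ≡ true → A
⌊⌋-true⁻ (yes a) _ = a

private
  module ΣN = FinSum ℕP.+-0-commutativeMonoid
  module ΣZ = FinSum ℤP.+-0-commutativeMonoid
  module ΣQ = FinSum ℚP.+-0-commutativeMonoid

Σℕ≡sum : ∀ n (f : Fin n → ℕ) → Σℕ n f ≡ ΣN.sum f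
Σℕ≡sum zero    f = refl
Σℕ≡sum (suc n) f = cong (f zero ℕ.+_) (Σℕ≡sum n (f ∘ suc))

Σℤ≡sum : ∀ n (f : Fin n → ℤ) → Σℤ n f ≡ ΣZ.sum f
Σℤ≡sum zero    f = refl
Σℤ≡sum (suc n) f = cong (ℤ._+_ (f zero)) (Σℤ≡sum n (f ∘ suc))

Σℚ≡sum : ∀ n (f : Fin n → ℚ) → Σℚ n f ≡ ΣQ.sum f
Σℚ≡sum zero    f = refl
Σℚ≡sum (suc n) f = cong (f zero ℚ.+_) (Σℚ≡sum n (f ∘ suc))

Σℕ-cong : ∀ n {f g : Fin n → ℕ} → (∀ i → f i ≡ g i) → Σℕ n f ≡ Σℕ n g
Σℕ-cong zero    f≗g = refl
Σℕ-cong (suc n) f≗g = cong₂ ℕ._+_ (f≗g zero) (Σℕ-cong n (f≗g ∘ suc))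

Σℤ-cong : ∀ n {f g : Fin n → ℤ} → (∀ i → f i ≡ g i) → Σℤ n f ≡ Σℤ n g
Σℤ-cong zero    f≗g = refl
Σℤ-cong (suc n) f≗g = cong₂ ℤ._+_ (f≗g zero) (Σℤ-cong n (f≗g ∘ suc))

Σℚ-cong : ∀ n {f g : Fin n → ℚ} → (∀ i → f i ≡ g i) → Σℚ n f ≡ Σℚ n g
Σℚ-cong zero    f≗g = refl
Σℚ-cong (suc n) f≗g = cong₂ ℚ._+_ (f≗g zero) (Σℚ-cong n (f≗g ∘ suc))

Σℕ-+ : ∀ n (f g : Fin n → ℕ) → Σℕ n (λ i → f i ℕ.+ g i) ≡ Σℕ n f ℕ.+ Σℕ n g
Σℕ-+ n f g = begin
  Σℕ n (λ i → f i ℕ.+ g i)    ≡⟨ Σℕ≡sum n _ ⟩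
  ΣN.sum (λ i → f i ℕ.+ g i)  ≡⟨ ΣN.∑-distrib-+ f g ⟩
  ΣN.sum f ℕ.+ ΣN.sum g       ≡⟨ cong₂ ℕ._+_ (Σℕ≡sum n f) (Σℕ≡sum n g) ⟨
  Σℕ n f ℕ.+ Σℕ n g           ∎
  where open ≡-Reasoning

Σℤ-+ : ∀ n (f g : Fin n → ℤ) → Σℤ n (λ i → f i ℤ.+ g i) ≡ Σℤ n f ℤ.+ Σℤ n g
Σℤ-+ n f g = begin
  Σℤ n (λ i → f i ℤ.+ g i)    ≡⟨ Σℤ≡sum n _ ⟩
  ΣZ.sum (λ i → f i ℤ.+ g i)  ≡⟨ ΣZ.∑-distrib-+ f g ⟩
  ΣZ.sum f ℤ.+ ΣZ.sum g       ≡⟨ cong₂ ℤ._+_ (Σℤ≡sum n f) (Σℤ≡sum n g) ⟨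
  Σℤ n f ℤ.+ Σℤ n g           ∎
  where open ≡-Reasoning

Σℚ-+ : ∀ n (f g : Fin n → ℚ) → Σℚ n (λ i → f i ℚ.+ g i) ≡ Σℚ n f ℚ.+ Σℚ n g
Σℚ-+ n f g = begin
  Σℚ n (λ i → f i ℚ.+ g i)    ≡⟨ Σℚ≡sum n _ ⟩
  ΣQ.sum (λ i → f i ℚ.+ g i)  ≡⟨ ΣQ.∑-distrib-+ f g ⟩
  ΣQ.sum f ℚ.+ ΣQ.sum g       ≡⟨ cong₂ ℚ._+_ (Σℚ≡sum n f) (Σℚ≡sum n g) ⟨
  Σℚ n f ℚ.+ Σℚ n g           ∎
  where open ≡-Reasoning

Σℕ-comm : ∀ m n (f : Fin m → Fin n → ℕ) →
          Σℕ m (λ u → Σℕ n (f u)) ≡ Σℕ n (λ v → Σℕ m (λ u → f u v))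
Σℕ-comm m n f = begin
  Σℕ m (λ u → Σℕ n (f u))              ≡⟨ Σℕ-cong m (λ u → Σℕ≡sum n (f u)) ⟩
  Σℕ m (λ u → ΣN.sum (f u))            ≡⟨ Σℕ≡sum m _ ⟩
  ΣN.sum (λ u → ΣN.sum (f u))          ≡⟨ ΣN.∑-comm f ⟩
  ΣN.sum (λ v → ΣN.sum (λ u → f u v))  ≡⟨ Σℕ≡sum n _ ⟨
  Σℕ n (λ v → ΣN.sum (λ u → f u v))    ≡⟨ Σℕ-cong n (λ v → Σℕ≡sum m (λ u → f u v)) ⟨
  Σℕ n (λ v → Σℕ m (λ u → f u v))      ∎
  where open ≡-Reasoning

Σℚ-comm : ∀ m n (f : Fin m → Fin n → ℚ) →
          Σℚ m (λ u → Σℚ n (f u)) ≡ Σℚ n (λ v → Σℚ m (λ u → f u v))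
Σℚ-comm m n f = begin
  Σℚ m (λ u → Σℚ n (f u))              ≡⟨ Σℚ-cong m (λ u → Σℚ≡sum n (f u)) ⟩
  Σℚ m (λ u → ΣQ.sum (f u))            ≡⟨ Σℚ≡sum m _ ⟩
  ΣQ.sum (λ u → ΣQ.sum (f u))          ≡⟨ ΣQ.∑-comm f ⟩
  ΣQ.sum (λ v → ΣQ.sum (λ u → f u v))  ≡⟨ Σℚ≡sum n _ ⟨
  Σℚ n (λ v → ΣQ.sum (λ u → f u v))    ≡⟨ Σℚ-cong n (λ v → Σℚ≡sum m (λ u → f u v)) ⟨
  Σℚ n (λ v → Σℚ m (λ u → f u v))      ∎
  where open ≡-Reasoning

Σℕ-const : ∀ n c → Σℕ n (λ _ → c) ≡ n ℕ.* c
Σℕ-const zero    c = refl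
Σℕ-const (suc n) c = cong (c ℕ.+_) (Σℕ-const n c)

Σℕ-ones : ∀ n → Σℕ n (λ _ → 1) ≡ n
Σℕ-ones n = trans (Σℕ-const n 1) (ℕP.*-identityʳ n)

Σℕ-mono : ∀ n {f g : Fin n → ℕ} → (∀ i → f i ≤ g i) → Σℕ n f ≤ Σℕ n g
Σℕ-mono zero    f≤g = z≤n
Σℕ-mono (suc n) f≤g = ℕP.+-mono-≤ (f≤g zero) (Σℕ-mono n (f≤g ∘ suc))

Σℚ-mono : ∀ n {f g : Fin n → ℚ} → (∀ i → f i ℚ.≤ g i) → Σℚ n f ℚ.≤ Σℚ n g
Σℚ-mono zero    f≤g = ℚP.≤-refl
Σℚ-mono (suc n) f≤g = ℚP.+-mono-≤ (f≤g zero) (Σℚ-mono n (f≤g ∘ suc))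

ℚ-+-tight : ∀ {a b c d} → a ℚ.≤ b → c ℚ.≤ d → b ℚ.+ d ℚ.≤ a ℚ.+ c → a ≡ b × d ℚ.≤ c
ℚ-+-tight a≤b c≤d b+d≤a+c =
    ℚP.≤-antisym a≤b (ℚP.≮⇒≥ (λ a<b → <⇒≱ (ℚP.+-mono-<-≤ a<b c≤d) b+d≤a+c))
  , ℚP.≮⇒≥ (λ c<d → <⇒≱ (ℚP.+-mono-≤-< a≤b c<d) b+d≤a+c)
  where
  <⇒≱ : ∀ {x y} → x ℚ.< y → ¬ y ℚ.≤ x
  <⇒≱ x<y y≤x = ℚP.<-irrefl refl (ℚP.<-≤-trans x<y y≤x)

Σℚ-mono-tight : ∀ n {f g : Fin n → ℚ} → (∀ i → f i ℚ.≤ g i) → Σℚ n g ℚ.≤ Σℚ n f →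
                ∀ i → f i ≡ g i
Σℚ-mono-tight (suc n) f≤g Σg≤Σf i with ℚ-+-tight (f≤g zero) (Σℚ-mono n (f≤g ∘ suc)) Σg≤Σf
Σℚ-mono-tight (suc n) f≤g Σg≤Σf zero    | f₀≡g₀ , _    = f₀≡g₀
Σℚ-mono-tight (suc n) f≤g Σg≤Σf (suc i) | _ , Σg≤Σf′ = Σℚ-mono-tight n (f≤g ∘ suc) Σg≤Σf′ i

count : ∀ {n} → (Fin n → Bool) → ℕ
count {n} b = Σℕ n (λ i → if b i then 1 else 0)

count-split : ∀ {n} (b c : Fin n → Bool) →
              count (λ i → b i ∧ not (c i)) ℕ.+ count (λ i → b i ∧ c i) ≡ count b
count-split {n} b c = trans (sym (Σℕ-+ n _ _)) (Σℕ-cong n (λ i → split (b i) (c i)))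
  where
  split : ∀ x y → (if x ∧ not y then 1 else 0) ℕ.+ (if x ∧ y then 1 else 0) ≡ (if x then 1 else 0)
  split true  true  = refl
  split true  false = refl
  split false y     = refl

count-≟ : ∀ {n} (a : Fin n) → count (λ v → ⌊ a ≟ v ⌋) ≡ 1
count-≟ {suc n} zero    = cong suc (trans (Σℕ-const n 0) (ℕP.*-zeroʳ n))
count-≟ {suc n} (suc a) =
  trans (Σℕ-cong n (λ v → cong (λ b → if b then 1 else 0) (⌊⌋-map′ _ _ (a ≟ v)))) (count-≟ a)

count≤1 : ∀ {n} (b : Fin n → Bool) → (∀ i j → b i ≡ true → b j ≡ true → i ≡ j) → count b ≤ 1
count≤1 {zero}  b unique = z≤n
count≤1 {suc n} b unique with b zero in b₀
... | true  = ℕP.≤-reflexive (cong suc (trans (Σℕ-cong n none) (trans (Σℕ-const n 0) (ℕP.*-zeroʳ n))))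
  where
  none : ∀ i → (if b (suc i) then 1 else 0) ≡ 0
  none i with b (suc i) in bᵢ
  ... | true  with () ← unique zero (suc i) b₀ bᵢ
  ... | false = refl
... | false = count≤1 (b ∘ suc) (λ i j bᵢ bⱼ → suc-injective (unique (suc i) (suc j) bᵢ bⱼ))

Σℕ≤1≡n⇒≡1 : ∀ n (g : Fin n → ℕ) → (∀ i → g i ≤ 1) → Σℕ n g ≡ n → ∀ i → g i ≡ 1
Σℕ≤1≡n⇒≡1 (suc n) g g≤1 Σg≡n = termwise
  where
  rest≤n : Σℕ n (g ∘ suc) ≤ n
  rest≤n = subst (Σℕ n (g ∘ suc) ≤_) (Σℕ-ones n) (Σℕ-mono n (g≤1 ∘ suc))
  g₀≡1 : g zero ≡ 1
  g₀≡1 = ℕP.≤-antisym (g≤1 zero)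
           (ℕP.+-cancelʳ-≤ n 1 (g zero) (subst (_≤ g zero ℕ.+ n) Σg≡n (ℕP.+-monoʳ-≤ (g zero) rest≤n)))
  termwise : ∀ i → g i ≡ 1
  termwise zero    = g₀≡1
  termwise (suc i) = Σℕ≤1≡n⇒≡1 n (g ∘ suc) (g≤1 ∘ suc)
                       (ℕP.suc-injective (trans (cong (ℕ._+ Σℕ n (g ∘ suc)) (sym g₀≡1)) Σg≡n)) i

Σℤ-pos : ∀ n (f : Fin n → ℕ) → Σℤ n (λ i → + f i) ≡ + Σℕ n f
Σℤ-pos zero    f = refl
Σℤ-pos (suc n) f = trans (cong (ℤ._+_ (+ f zero)) (Σℤ-pos n (f ∘ suc))) (sym (ℤP.pos-+ (f zero) _))

∣p∣≡count : ∀ {n} (p : Subset n) → ∣ p ∣ ≡ count (lookup p)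
∣p∣≡count []            = refl
∣p∣≡count (inside  ∷ p) = cong suc (∣p∣≡count p)
∣p∣≡count (outside ∷ p) = ∣p∣≡count p

Σℤ-indicator : ∀ {n} (S : Subset n) → Σℤ n (λ i → + (if lookup S i then 1 else 0)) ≡ + ∣ S ∣
Σℤ-indicator {n} S = trans (Σℤ-pos n _) (cong +_ (sym (∣p∣≡count S)))

PM-mono : ∀ {m n} {A B M : EdgeSet m n} → A ⊆E B → IsPerfectMatching A M → IsPerfectMatching B M
PM-mono A⊆B (M⊆A , degU≡1 , degV≡1) = (λ u v → A⊆B u v ∘ M⊆A u v) , degU≡1 , degV≡1

PM⇒square : ∀ {m n} {E M : EdgeSet m n} → IsPerfectMatching E M → m ≡ n
PM⇒square {m} {n} {M = M} (_ , degU≡1 , degV≡1) = begin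
  m                ≡⟨ Σℕ-ones m ⟨
  Σℕ m (λ _ → 1)   ≡⟨ Σℕ-cong m degU≡1 ⟨
  Σℕ m (degU M)    ≡⟨ Σℕ-comm m n _ ⟩
  Σℕ n (degV M)    ≡⟨ Σℕ-cong n degV≡1 ⟩
  Σℕ n (λ _ → 1)   ≡⟨ Σℕ-ones n ⟩
  n                ∎
  where open ≡-Reasoning

graph : ∀ {m n} → (Fin m → Fin n) → EdgeSet m n
graph f u v = ⌊ f u ≟ v ⌋

injection⇒PM : ∀ {n} (H : EdgeSet n n) (f : Fin n → Fin n) →
               (∀ u → H u (f u) ≡ true) → Injective _≡_ _≡_ f → IsPerfectMatching H (graph f)
injection⇒PM {n} H f edge f-injective = graph⊆H , degU≡1 , degV≡1
  where
  open ≡-Reasoning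
  graph⊆H : graph f ⊆E H
  graph⊆H u v fu≡v = subst (λ v → H u v ≡ true) (⌊⌋-true⁻ (f u ≟ v) fu≡v) (edge u)
  degU≡1 : ∀ u → degU (graph f) u ≡ 1
  degU≡1 u = count-≟ (f u)
  degV≤1 : ∀ v → degV (graph f) v ≤ 1
  degV≤1 v = count≤1 _ λ i j fi≡v fj≡v →
    f-injective (trans (⌊⌋-true⁻ (f i ≟ v) fi≡v) (sym (⌊⌋-true⁻ (f j ≟ v) fj≡v)))
  ΣdegV≡n : Σℕ n (degV (graph f)) ≡ n
  ΣdegV≡n = begin
    Σℕ n (degV (graph f))   ≡⟨ Σℕ-comm n n _ ⟨
    Σℕ n (degU (graph f))   ≡⟨ Σℕ-cong n degU≡1 ⟩
    Σℕ n (λ _ → 1)          ≡⟨ Σℕ-ones n ⟩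
    n                       ∎
  degV≡1 : ∀ v → degV (graph f) v ≡ 1
  degV≡1 = Σℕ≤1≡n⇒≡1 n _ degV≤1 ΣdegV≡n

weightOf-wp+card∩ : ∀ {m n} (Ep M : EdgeSet m n) → (∀ u → degU M u ≡ 1) →
                    weightOf (wp Ep) M ℤ.+ + card∩ M Ep ≡ + m
weightOf-wp+card∩ {m} {n} Ep M degU≡1 = begin
  weightOf (wp Ep) M ℤ.+ + card∩ M Ep
    ≡⟨ cong (ℤ._+ + card∩ M Ep) wp-weight ⟩
  + Σℕ m outsideEp ℤ.+ + card∩ M Ep
    ≡⟨ ℤP.pos-+ (Σℕ m outsideEp) (card∩ M Ep) ⟨
  + (Σℕ m outsideEp ℕ.+ card∩ M Ep)
    ≡⟨ cong +_ (Σℕ-+ m _ _) ⟨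
  + Σℕ m (λ u → outsideEp u ℕ.+ count (λ v → M u v ∧ Ep u v))
    ≡⟨ cong +_ (Σℕ-cong m (λ u → count-split (M u) (Ep u))) ⟩
  + Σℕ m (degU M)
    ≡⟨ cong +_ (trans (Σℕ-cong m degU≡1) (Σℕ-ones m)) ⟩
  + m ∎
  where
  open ≡-Reasoning
  outsideEp : Fin m → ℕ
  outsideEp u = count (λ v → M u v ∧ not (Ep u v))
  termwise : ∀ x y → (if x then (if y then + 0 else + 1) else + 0) ≡ + (if x ∧ not y then 1 else 0)
  termwise true  true  = refl
  termwise true  false = refl
  termwise false y     = refl
  wp-weight : weightOf (wp Ep) M ≡ + Σℕ m outsideEp
  wp-weight = trans (Σℤ-cong m (λ u → trans (Σℤ-cong n (λ v → termwise (M u v) (Ep u v))) (Σℤ-pos n _)))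
                    (Σℤ-pos m _)

card∩-antitone : ∀ {m n} (Ep M M′ : EdgeSet m n) → (∀ u → degU M u ≡ 1) → (∀ u → degU M′ u ≡ 1) →
                 weightOf (wp Ep) M ℤ.≤ weightOf (wp Ep) M′ → card∩ M′ Ep ≤ card∩ M Ep
card∩-antitone Ep M M′ degU≡1 degU′≡1 wp≤wp′ = ℕP.≮⇒≥ λ M∩Ep<M′∩Ep →
  ℤP.<-irrefl (trans (weightOf-wp+card∩ Ep M degU≡1) (sym (weightOf-wp+card∩ Ep M′ degU′≡1)))
              (ℤP.+-mono-≤-< wp≤wp′ (ℤ.+<+ M∩Ep<M′∩Ep))

-- Duality

toℚ≡mkℚ : ∀ i → toℚ i ≡ mkℚ i 0 (Coprime.sym (Coprime.1-coprimeTo _))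
toℚ≡mkℚ i = ℚP.↥p/↧p≡p (mkℚ i 0 (Coprime.sym (Coprime.1-coprimeTo _)))

toℚ-+ : ∀ i j → toℚ (i ℤ.+ j) ≡ toℚ i ℚ.+ toℚ j
toℚ-+ i j rewrite toℚ≡mkℚ i | toℚ≡mkℚ j =
  cong₂ (λ x y → (x ℤ.+ y) ℚ./ 1) (sym (ℤP.*-identityʳ i)) (sym (ℤP.*-identityʳ j))

toℚ-mono-≤ : ∀ {i j} → i ℤ.≤ j → toℚ i ℚ.≤ toℚ j
toℚ-mono-≤ {i} {j} i≤j rewrite toℚ≡mkℚ i | toℚ≡mkℚ j =
  ℚ.*≤* (subst₂ ℤ._≤_ (sym (ℤP.*-identityʳ i)) (sym (ℤP.*-identityʳ j)) i≤j)

toℚ-cancel-≤ : ∀ {i j} → toℚ i ℚ.≤ toℚ j → i ℤ.≤ j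
toℚ-cancel-≤ {i} {j} i≤j rewrite toℚ≡mkℚ i | toℚ≡mkℚ j with i≤j
... | ℚ.*≤* i*1≤j*1 = subst₂ ℤ._≤_ (ℤP.*-identityʳ i) (ℤP.*-identityʳ j) i*1≤j*1

toℚ-Σ : ∀ n (f : Fin n → ℤ) → toℚ (Σℤ n f) ≡ Σℚ n (toℚ ∘ f)
toℚ-Σ zero    f = refl
toℚ-Σ (suc n) f = trans (toℚ-+ (f zero) _) (cong (toℚ (f zero) ℚ.+_) (toℚ-Σ n (f ∘ suc)))

when : Bool → ℚ → ℚ
when b x = if b then x else 0ℚ

Σℚ-when : ∀ n (b : Fin n → Bool) x → Σℚ n (λ i → when (b i) x) ≡ count b ×ℚ x
Σℚ-when zero    b x = refl
Σℚ-when (suc n) b x with b zero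
... | true  = cong (x ℚ.+_) (Σℚ-when n (b ∘ suc) x)
... | false = trans (ℚP.+-identityˡ _) (Σℚ-when n (b ∘ suc) x)

toℚ-weightOf : ∀ {m n} (w : Weight m n) (M : EdgeSet m n) →
               toℚ (weightOf w M) ≡ Σℚ m (λ u → Σℚ n (λ v → when (M u v) (toℚ (w u v))))
toℚ-weightOf {m} {n} w M =
  trans (toℚ-Σ m _) (Σℚ-cong m (λ u → trans (toℚ-Σ n _) (Σℚ-cong n (λ v → toℚ-if (M u v)))))
  where
  toℚ-if : ∀ {z} b → toℚ (if b then z else + 0) ≡ when b (toℚ z)
  toℚ-if true  = refl
  toℚ-if false = refl

Σℚ-PM : ∀ {m n} {E M : EdgeSet m n} → IsPerfectMatching E M → (π : Fin m → ℚ) (p : Fin n → ℚ) →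
        Σℚ m (λ u → Σℚ n (λ v → when (M u v) (π u ℚ.+ p v))) ≡ Σℚ m π ℚ.+ Σℚ n p
Σℚ-PM {m} {n} {M = M} (_ , degU≡1 , degV≡1) π p = begin
  Σℚ m (λ u → Σℚ n (λ v → when (M u v) (π u ℚ.+ p v)))
    ≡⟨ Σℚ-cong m (λ u → trans (Σℚ-cong n (λ v → when-+ (M u v))) (Σℚ-+ n _ _)) ⟩
  Σℚ m (λ u → Σℚ n (λ v → when (M u v) (π u)) ℚ.+ Σℚ n (λ v → when (M u v) (p v)))
    ≡⟨ Σℚ-+ m _ _ ⟩
  Σℚ m (λ u → Σℚ n (λ v → when (M u v) (π u))) ℚ.+ Σℚ m (λ u → Σℚ n (λ v → when (M u v) (p v)))
    ≡⟨ cong₂ ℚ._+_ (Σℚ-cong m (λ u → Σℚ-when n (M u) (π u))) (Σℚ-comm m n _) ⟩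
  Σℚ m (λ u → degU M u ×ℚ π u) ℚ.+ Σℚ n (λ v → Σℚ m (λ u → when (M u v) (p v)))
    ≡⟨ cong₂ ℚ._+_ (Σℚ-cong m (λ u → once (degU≡1 u)))
                   (Σℚ-cong n (λ v → trans (Σℚ-when m (λ u → M u v) (p v)) (once (degV≡1 v)))) ⟩
  Σℚ m π ℚ.+ Σℚ n p ∎
  where
  open ≡-Reasoning
  when-+ : ∀ {x y} b → when b (x ℚ.+ y) ≡ when b x ℚ.+ when b y
  when-+ true  = refl
  when-+ false = sym (ℚP.+-identityʳ 0ℚ)
  once : ∀ {k x} → k ≡ 1 → k ×ℚ x ≡ x
  once refl = ℚP.+-identityʳ _

module _ {m n} {E : EdgeSet m n} {w : Weight m n} {P : Prices m n} where

  Ecs⁻ : ∀ {u v} → Ecs E w P u v ≡ true → E u v ≡ true × π P u ℚ.+ p P v ≡ toℚ (w u v)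
  Ecs⁻ {u} {v} uv∈Ecs with E u v
  ... | true = refl , ⌊⌋-true⁻ (π P u ℚ.+ p P v ℚ.≟ toℚ (w u v)) uv∈Ecs

  Ecs⁺ : ∀ {u v} → E u v ≡ true → π P u ℚ.+ p P v ≡ toℚ (w u v) → Ecs E w P u v ≡ true
  Ecs⁺ {u} {v} uv∈E tight rewrite uv∈E = ⌊⌋-true (π P u ℚ.+ p P v ℚ.≟ toℚ (w u v)) tight

  Ecs⊆E : Ecs E w P ⊆E E
  Ecs⊆E u v = proj₁ ∘ Ecs⁻

  private
    potential cost : EdgeSet m n → Fin m → Fin n → ℚ
    potential M u v = when (M u v) (π P u ℚ.+ p P v)
    cost      M u v = when (M u v) (toℚ (w u v))

    potential≤cost : Feasible E w P → ∀ {M} → M ⊆E E → ∀ u v → potential M u v ℚ.≤ cost M u v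
    potential≤cost feasible {M} M⊆E u v with M u v in uv∈M
    ... | true  = feasible u v (M⊆E u v uv∈M)
    ... | false = ℚP.≤-refl

    Σpotential : ∀ {M} → IsPerfectMatching E M → Σℚ m (λ u → Σℚ n (potential M u)) ≡ dualValue P
    Σpotential pm = Σℚ-PM pm (π P) (p P)

  weakDuality : Feasible E w P → ∀ {M} → IsPerfectMatching E M → dualValue P ℚ.≤ toℚ (weightOf w M)
  weakDuality feasible {M} pm@(M⊆E , _) =
    subst₂ ℚ._≤_ (Σpotential pm) (sym (toℚ-weightOf w M))
      (Σℚ-mono m (λ u → Σℚ-mono n (potential≤cost feasible M⊆E u)))

  tightPM-weight : ∀ {M} → IsPerfectMatching (Ecs E w P) M → toℚ (weightOf w M) ≡ dualValue P
  tightPM-weight {M} pm@(M⊆Ecs , _) = begin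
    toℚ (weightOf w M)                  ≡⟨ toℚ-weightOf w M ⟩
    Σℚ m (λ u → Σℚ n (cost M u))        ≡⟨ Σℚ-cong m (λ u → Σℚ-cong n (tight u)) ⟨
    Σℚ m (λ u → Σℚ n (potential M u))   ≡⟨ Σpotential (PM-mono Ecs⊆E pm) ⟩
    dualValue P                         ∎
    where
    open ≡-Reasoning
    tight : ∀ u v → potential M u v ≡ cost M u v
    tight u v with M u v in uv∈M
    ... | true  = cong (when true) (proj₂ (Ecs⁻ (M⊆Ecs u v uv∈M)))
    ... | false = refl

  complementarySlackness : Feasible E w P → ∀ {M} → IsPerfectMatching E M →
                           toℚ (weightOf w M) ℚ.≤ dualValue P → M ⊆E Ecs E w P
  complementarySlackness feasible {M} pm@(M⊆E , _) w≤dual u v uv∈M =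
    Ecs⁺ (M⊆E u v uv∈M) (subst (λ b → when b _ ≡ when b _) uv∈M (termwise u v))
    where
    Σcost≤Σpotential : Σℚ m (λ u → Σℚ n (cost M u)) ℚ.≤ Σℚ m (λ u → Σℚ n (potential M u))
    Σcost≤Σpotential = subst₂ ℚ._≤_ (toℚ-weightOf w M) (sym (Σpotential pm)) w≤dual
    rowwise : ∀ u → Σℚ n (potential M u) ≡ Σℚ n (cost M u)
    rowwise = Σℚ-mono-tight m (λ u → Σℚ-mono n (potential≤cost feasible M⊆E u)) Σcost≤Σpotential
    termwise : ∀ u v → potential M u v ≡ cost M u v
    termwise u = Σℚ-mono-tight n (potential≤cost feasible M⊆E u) (ℚP.≤-reflexive (sym (rowwise u)))

  tightPM⇒minWeight : Feasible E w P → ∀ {M} → IsPerfectMatching (Ecs E w P) M → IsMinWeightPM E w M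
  tightPM⇒minWeight feasible pm = PM-mono Ecs⊆E pm , λ M′ pm′ →
    toℚ-cancel-≤ (subst (ℚ._≤ toℚ (weightOf w M′)) (sym (tightPM-weight pm)) (weakDuality feasible pm′))

-- Hall's theorem

x∈p─q⇒x∉q : ∀ {n} {x : Fin n} {p q : Subset n} → x ∈ p ─ q → x ∉ q
x∈p─q⇒x∉q {p = _ ∷ _} {inside  ∷ _} (there x∈p─q) (there x∈q) = x∈p─q⇒x∉q x∈p─q x∈q
x∈p─q⇒x∉q {p = _ ∷ _} {outside ∷ _} (there x∈p─q) (there x∈q) = x∈p─q⇒x∉q x∈p─q x∈q
x∈p─q⇒x∉q {p = _ ∷ _} {outside ∷ _} here ()

∣p∪q∣+∣p∩q∣≡∣p∣+∣q∣ : ∀ {n} (p q : Subset n) → ∣ p ∪ q ∣ ℕ.+ ∣ p ∩ q ∣ ≡ ∣ p ∣ ℕ.+ ∣ q ∣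
∣p∪q∣+∣p∩q∣≡∣p∣+∣q∣ []            []            = refl
∣p∪q∣+∣p∩q∣≡∣p∣+∣q∣ (inside  ∷ p) (inside  ∷ q) = cong suc (begin
  ∣ p ∪ q ∣ ℕ.+ suc ∣ p ∩ q ∣    ≡⟨ ℕP.+-suc _ _ ⟩
  suc (∣ p ∪ q ∣ ℕ.+ ∣ p ∩ q ∣)  ≡⟨ cong suc (∣p∪q∣+∣p∩q∣≡∣p∣+∣q∣ p q) ⟩
  suc (∣ p ∣ ℕ.+ ∣ q ∣)          ≡⟨ ℕP.+-suc _ _ ⟨
  ∣ p ∣ ℕ.+ suc ∣ q ∣            ∎)
  where open ≡-Reasoning
∣p∪q∣+∣p∩q∣≡∣p∣+∣q∣ (inside  ∷ p) (outside ∷ q) = cong suc (∣p∪q∣+∣p∩q∣≡∣p∣+∣q∣ p q)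
∣p∪q∣+∣p∩q∣≡∣p∣+∣q∣ (outside ∷ p) (inside  ∷ q) =
  trans (cong suc (∣p∪q∣+∣p∩q∣≡∣p∣+∣q∣ p q)) (sym (ℕP.+-suc _ _))
∣p∪q∣+∣p∩q∣≡∣p∣+∣q∣ (outside ∷ p) (outside ∷ q) = ∣p∪q∣+∣p∩q∣≡∣p∣+∣q∣ p q

∣p∪q∣≤∣p∣+∣q∣ : ∀ {n} (p q : Subset n) → ∣ p ∪ q ∣ ≤ ∣ p ∣ ℕ.+ ∣ q ∣
∣p∪q∣≤∣p∣+∣q∣ p q = subst (∣ p ∪ q ∣ ≤_) (∣p∪q∣+∣p∩q∣≡∣p∣+∣q∣ p q) (ℕP.m≤m+n _ _)

Empty⇒∣p∣≡0 : ∀ {n} {p : Subset n} → Empty p → ∣ p ∣ ≡ 0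
Empty⇒∣p∣≡0 {n} p-empty = trans (cong ∣_∣ (Empty-unique p-empty)) (∣⊥∣≡0 n)

∣p∪q∣≡∣p∣+∣q∣ : ∀ {n} (p q : Subset n) → (∀ {x} → x ∈ p → x ∉ q) → ∣ p ∪ q ∣ ≡ ∣ p ∣ ℕ.+ ∣ q ∣
∣p∪q∣≡∣p∣+∣q∣ p q disjoint = begin
  ∣ p ∪ q ∣                 ≡⟨ ℕP.+-identityʳ _ ⟨
  ∣ p ∪ q ∣ ℕ.+ 0           ≡⟨ cong (∣ p ∪ q ∣ ℕ.+_) (Empty⇒∣p∣≡0 p∩q-empty) ⟨
  ∣ p ∪ q ∣ ℕ.+ ∣ p ∩ q ∣   ≡⟨ ∣p∪q∣+∣p∩q∣≡∣p∣+∣q∣ p q ⟩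
  ∣ p ∣ ℕ.+ ∣ q ∣           ∎
  where
  open ≡-Reasoning
  p∩q-empty : Empty (p ∩ q)
  p∩q-empty (x , x∈p∩q) = let x∈p , x∈q = x∈p∩q⁻ p q x∈p∩q in disjoint x∈p x∈q

0<∣p∣⇒nonempty : ∀ {n} {p : Subset n} → 0 < ∣ p ∣ → Nonempty p
0<∣p∣⇒nonempty {p = p} 0<∣p∣ with nonempty? p
... | yes p≢∅ = p≢∅
... | no  p≡∅ = ⊥-elim (ℕP.<-irrefl (sym (Empty⇒∣p∣≡0 p≡∅)) 0<∣p∣)

∈-tabulate⁺ : ∀ {n} {f : Fin n → Bool} {x} → f x ≡ true → x ∈ tabulate f
∈-tabulate⁺ {f = f} {x} fx≡true = lookup⇒[]= x (tabulate f) (trans (lookup∘tabulate f x) fx≡true)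

∈-tabulate⁻ : ∀ {n} {f : Fin n → Bool} {x} → x ∈ tabulate f → f x ≡ true
∈-tabulate⁻ {f = f} {x} x∈f = trans (sym (lookup∘tabulate f x)) ([]=⇒lookup x∈f)

module Hall {m n} (H : EdgeSet m n) where

  N : Subset m → Subset n
  N S = tabulate (λ v → ⌊ any? (λ u → u ∈? S ×-dec H u v Bool.≟ true) ⌋)

  ∈N⁺ : ∀ {S u v} → u ∈ S → H u v ≡ true → v ∈ N S
  ∈N⁺ u∈S huv = ∈-tabulate⁺ (⌊⌋-true (any? _) (_ , u∈S , huv))

  ∈N⁻ : ∀ {S v} → v ∈ N S → ∃ λ u → u ∈ S × H u v ≡ true
  ∈N⁻ v∈NS = ⌊⌋-true⁻ (any? _) (∈-tabulate⁻ v∈NS)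

  N-mono : ∀ {S T} → S ⊆ T → N S ⊆ N T
  N-mono S⊆T v∈NS = let u , u∈S , huv = ∈N⁻ v∈NS in ∈N⁺ (S⊆T u∈S) huv

  N-∪ : ∀ S T → N (S ∪ T) ⊆ N S ∪ N T
  N-∪ S T v∈N[S∪T] = let u , u∈S∪T , huv = ∈N⁻ v∈N[S∪T] in
    x∈p∪q⁺ (Sum.map (λ u∈S → ∈N⁺ u∈S huv) (λ u∈T → ∈N⁺ u∈T huv) (x∈p∪q⁻ S T u∈S∪T))

  HallCondition : Subset m → Subset n → Set
  HallCondition A B = ∀ {S} → S ⊆ A → ∣ S ∣ ≤ ∣ N S ∩ B ∣

  -- The mate of u depends on the proof of u ∈ A, so that A = ∅ is matchable even when
  -- there is no vertex at all on the other side.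
  record Matching (A : Subset m) (B : Subset n) : Set where
    field
      mate           : ∀ {u} → u ∈ A → Fin n
      mate-edge      : ∀ {u} (u∈A : u ∈ A) → H u (mate u∈A) ≡ true
      mate-∈         : ∀ {u} (u∈A : u ∈ A) → mate u∈A ∈ B
      mate-injective : ∀ {u u′} (u∈A : u ∈ A) (u′∈A : u′ ∈ A) → mate u∈A ≡ mate u′∈A → u ≡ u′
  open Matching

  emptyMatching : ∀ {A B} → Empty A → Matching A B
  emptyMatching A-empty = record
    { mate           = λ u∈A → ⊥-elim (A-empty (_ , u∈A))
    ; mate-edge      = λ u∈A → ⊥-elim (A-empty (_ , u∈A))
    ; mate-∈         = λ u∈A → ⊥-elim (A-empty (_ , u∈A))
    ; mate-injective = λ u∈A _ _ → ⊥-elim (A-empty (_ , u∈A))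
    }

  edgeMatching : ∀ {u v} → H u v ≡ true → Matching ⁅ u ⁆ ⁅ v ⁆
  edgeMatching {u} {v} huv = record
    { mate           = λ _ → v
    ; mate-edge      = λ x∈⁅u⁆ → subst (λ x → H x v ≡ true) (sym (x∈⁅y⁆⇒x≡y u x∈⁅u⁆)) huv
    ; mate-∈         = λ _ → x∈⁅x⁆ v
    ; mate-injective = λ x∈⁅u⁆ y∈⁅u⁆ _ → trans (x∈⁅y⁆⇒x≡y u x∈⁅u⁆) (sym (x∈⁅y⁆⇒x≡y u y∈⁅u⁆))
    }

  joinMatchings : ∀ {A B} S {B₁ B₂} → Matching S B₁ → Matching (A ─ S) B₂ →
                  (∀ {v} → v ∈ B₁ → v ∉ B₂) → B₁ ⊆ B → B₂ ⊆ B → Matching A B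
  joinMatchings {A} {B} S {B₁} {B₂} M₁ M₂ disjoint B₁⊆B B₂⊆B = record
    { mate           = λ u∈A → mate′ u∈A (_ ∈? S)
    ; mate-edge      = λ u∈A → edge′ u∈A (_ ∈? S)
    ; mate-∈         = λ u∈A → ∈B′ u∈A (_ ∈? S)
    ; mate-injective = λ u∈A u′∈A → injective′ u∈A u′∈A (_ ∈? S) (_ ∈? S)
    }
    where
    mate′ : ∀ {u} → u ∈ A → Dec (u ∈ S) → Fin n
    mate′ u∈A (yes u∈S) = mate M₁ u∈S
    mate′ u∈A (no  u∉S) = mate M₂ (x∈p∧x∉q⇒x∈p─q u∈A u∉S)
    edge′ : ∀ {u} (u∈A : u ∈ A) d → H u (mate′ u∈A d) ≡ true
    edge′ u∈A (yes u∈S) = mate-edge M₁ u∈S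
    edge′ u∈A (no  u∉S) = mate-edge M₂ _
    ∈B′ : ∀ {u} (u∈A : u ∈ A) d → mate′ u∈A d ∈ B
    ∈B′ u∈A (yes u∈S) = B₁⊆B (mate-∈ M₁ u∈S)
    ∈B′ u∈A (no  u∉S) = B₂⊆B (mate-∈ M₂ _)
    injective′ : ∀ {u u′} (u∈A : u ∈ A) (u′∈A : u′ ∈ A) d d′ → mate′ u∈A d ≡ mate′ u′∈A d′ → u ≡ u′
    injective′ _ _ (yes u∈S) (yes u′∈S) eq = mate-injective M₁ u∈S u′∈S eq
    injective′ _ _ (no  u∉S) (no  u′∉S) eq = mate-injective M₂ _ _ eq
    injective′ _ _ (yes u∈S) (no  u′∉S) eq =
      ⊥-elim (disjoint (mate-∈ M₁ u∈S) (subst (_∈ B₂) (sym eq) (mate-∈ M₂ _)))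
    injective′ _ _ (no  u∉S) (yes u′∈S) eq =
      ⊥-elim (disjoint (mate-∈ M₁ u′∈S) (subst (_∈ B₂) eq (mate-∈ M₂ _)))

  Critical : Subset m → Subset n → Subset m → Set
  Critical A B S = Nonempty S × S ⊂ A × ∣ N S ∩ B ∣ ≤ ∣ S ∣

  critical? : ∀ A B S → Dec (Critical A B S)
  critical? A B S = nonempty? S ×-dec S ⊂? A ×-dec ∣ N S ∩ B ∣ ℕP.≤? ∣ S ∣

  hall-restrict : ∀ {A B S} → HallCondition A B → S ⊆ A → HallCondition S (N S ∩ B)
  hall-restrict {B = B} {S} hallAB S⊆A {T} T⊆S =
    ℕP.≤-trans (hallAB (⊆-trans T⊆S S⊆A)) (p⊆q⇒∣p∣≤∣q∣ inclusion)
    where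
    inclusion : N T ∩ B ⊆ N T ∩ (N S ∩ B)
    inclusion v∈ = let v∈NT , v∈B = x∈p∩q⁻ (N T) B v∈ in x∈p∩q⁺ (v∈NT , x∈p∩q⁺ (N-mono T⊆S v∈NT , v∈B))

  hall-remove-tight : ∀ {A B S} → HallCondition A B → S ⊆ A → ∣ N S ∩ B ∣ ≤ ∣ S ∣ →
                      HallCondition (A ─ S) (B ─ N S)
  hall-remove-tight {A} {B} {S} hallAB S⊆A tight {T} T⊆A─S =
    ℕP.+-cancelʳ-≤ (∣ S ∣) (∣ T ∣) (∣ N T ∩ (B ─ N S) ∣) (begin
      ∣ T ∣ ℕ.+ ∣ S ∣                        ≡⟨ ∣p∪q∣≡∣p∣+∣q∣ T S (x∈p─q⇒x∉q ∘ T⊆A─S) ⟨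
      ∣ T ∪ S ∣                              ≤⟨ hallAB T∪S⊆A ⟩
      ∣ N (T ∪ S) ∩ B ∣                      ≤⟨ p⊆q⇒∣p∣≤∣q∣ inclusion ⟩
      ∣ (N T ∩ (B ─ N S)) ∪ (N S ∩ B) ∣      ≤⟨ ∣p∪q∣≤∣p∣+∣q∣ (N T ∩ (B ─ N S)) (N S ∩ B) ⟩
      ∣ N T ∩ (B ─ N S) ∣ ℕ.+ ∣ N S ∩ B ∣    ≤⟨ ℕP.+-monoʳ-≤ ∣ N T ∩ (B ─ N S) ∣ tight ⟩
      ∣ N T ∩ (B ─ N S) ∣ ℕ.+ ∣ S ∣          ∎)
    where
    open ℕP.≤-Reasoning
    T∪S⊆A : T ∪ S ⊆ A
    T∪S⊆A x∈T∪S = Sum.[ p─q⊆p A S ∘ T⊆A─S , S⊆A ] (x∈p∪q⁻ T S x∈T∪S)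
    inclusion : N (T ∪ S) ∩ B ⊆ (N T ∩ (B ─ N S)) ∪ (N S ∩ B)
    inclusion {v} v∈ with x∈p∩q⁻ (N (T ∪ S)) B v∈ | v ∈? N S
    ... | _ , v∈B        | yes v∈NS = x∈p∪q⁺ (inj₂ (x∈p∩q⁺ (v∈NS , v∈B)))
    ... | v∈N[T∪S] , v∈B | no  v∉NS with x∈p∪q⁻ (N T) (N S) (N-∪ T S v∈N[T∪S])
    ...   | inj₁ v∈NT = x∈p∪q⁺ (inj₁ (x∈p∩q⁺ (v∈NT , x∈p∧x∉q⇒x∈p─q v∈B v∉NS)))
    ...   | inj₂ v∈NS = ⊥-elim (v∉NS v∈NS)

  hall-remove-pair : ∀ {A B u} v → HallCondition A B → (∀ S → ¬ Critical A B S) → u ∈ A →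
                     HallCondition (A - u) (B - v)
  hall-remove-pair {A} {B} {u} v hallAB noCritical u∈A {T} T⊆A-u with nonempty? T
  ... | no  T≡∅ = subst (_≤ ∣ N T ∩ (B - v) ∣) (sym (Empty⇒∣p∣≡0 T≡∅)) z≤n
  ... | yes T≢∅ = ℕP.+-cancelʳ-≤ 1 (∣ T ∣) (∣ N T ∩ (B - v) ∣) (begin
    ∣ T ∣ ℕ.+ 1                        ≡⟨ ℕP.+-comm ∣ T ∣ 1 ⟩
    suc ∣ T ∣                          ≤⟨ ℕP.≰⇒> (λ tight → noCritical T (T≢∅ , T⊂A , tight)) ⟩
    ∣ N T ∩ B ∣                        ≤⟨ p⊆q⇒∣p∣≤∣q∣ inclusion ⟩
    ∣ (N T ∩ (B - v)) ∪ ⁅ v ⁆ ∣        ≤⟨ ∣p∪q∣≤∣p∣+∣q∣ (N T ∩ (B - v)) ⁅ v ⁆ ⟩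
    ∣ N T ∩ (B - v) ∣ ℕ.+ ∣ ⁅ v ⁆ ∣    ≡⟨ cong (∣ N T ∩ (B - v) ∣ ℕ.+_) (∣⁅x⁆∣≡1 v) ⟩
    ∣ N T ∩ (B - v) ∣ ℕ.+ 1            ∎)
    where
    open ℕP.≤-Reasoning
    T⊂A : T ⊂ A
    T⊂A = p─q⊆p A ⁅ u ⁆ ∘ T⊆A-u , u , u∈A , (λ u∈T → x∈p─q⇒x∉q (T⊆A-u u∈T) (x∈⁅x⁆ u))
    inclusion : N T ∩ B ⊆ (N T ∩ (B - v)) ∪ ⁅ v ⁆
    inclusion {x} x∈ with x∈p∩q⁻ (N T) B x∈ | x ≟ v
    ... | _ , _      | yes refl = x∈p∪q⁺ (inj₂ (x∈⁅x⁆ x))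
    ... | x∈NT , x∈B | no  x≢v  = x∈p∪q⁺ (inj₁ (x∈p∩q⁺ (x∈NT , x∈p∧x≢y⇒x∈p-y x∈B x≢v)))

  -- Halmos–Vaughan: split A along a critical set if there is one; otherwise match any u ∈ A to
  -- any neighbour v ∈ B, which keeps Hall's condition for A - u and B - v.
  hall : ∀ {A} → Acc _⊂_ A → ∀ {B} → HallCondition A B → Matching A B
  hall {A} (acc smaller) {B} hallAB with anySubset? (critical? A B)
  ... | yes (S , (x , x∈S) , S⊂A@(S⊆A , _) , tight) =
    joinMatchings S
      (hall (smaller S⊂A) (hall-restrict hallAB S⊆A))
      (hall (smaller A─S⊂A) (hall-remove-tight hallAB S⊆A tight))
      (λ v∈NS∩B v∈B─NS → x∈p─q⇒x∉q v∈B─NS (proj₁ (x∈p∩q⁻ (N S) B v∈NS∩B)))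
      (p∩q⊆q (N S) B) (p─q⊆p B (N S))
    where
    A─S⊂A : A ─ S ⊂ A
    A─S⊂A = p∩q≢∅⇒p─q⊂p A S (x , x∈p∩q⁺ (S⊆A x∈S , x∈S))
  ... | no ∄critical with nonempty? A
  ...   | no  A≡∅       = emptyMatching A≡∅
  ...   | yes (u , u∈A) =
    joinMatchings ⁅ u ⁆ (edgeMatching huv)
      (hall (smaller (x∈p⇒p-x⊂p u∈A)) (hall-remove-pair v hallAB (λ S c → ∄critical (S , c)) u∈A))
      (λ x∈⁅v⁆ x∈B-v → x∈p─q⇒x∉q x∈B-v x∈⁅v⁆)
      (λ x∈⁅v⁆ → subst (_∈ B) (sym (x∈⁅y⁆⇒x≡y v x∈⁅v⁆)) v∈B) (p─q⊆p B ⁅ v ⁆)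
    where
    ⁅u⁆⊆A : ⁅ u ⁆ ⊆ A
    ⁅u⁆⊆A x∈⁅u⁆ = subst (_∈ A) (sym (x∈⁅y⁆⇒x≡y u x∈⁅u⁆)) u∈A
    neighbour : Nonempty (N ⁅ u ⁆ ∩ B)
    neighbour = 0<∣p∣⇒nonempty (subst (_≤ ∣ N ⁅ u ⁆ ∩ B ∣) (∣⁅x⁆∣≡1 u) (hallAB ⁅u⁆⊆A))
    v : Fin n
    v = proj₁ neighbour
    v∈N⁅u⁆ : v ∈ N ⁅ u ⁆
    v∈N⁅u⁆ = proj₁ (x∈p∩q⁻ (N ⁅ u ⁆) B (proj₂ neighbour))
    v∈B : v ∈ B
    v∈B = proj₂ (x∈p∩q⁻ (N ⁅ u ⁆) B (proj₂ neighbour))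
    huv : H u v ≡ true
    huv = let u′ , u′∈⁅u⁆ , hu′v = ∈N⁻ v∈N⁅u⁆ in subst (λ x → H x v ≡ true) (x∈⁅y⁆⇒x≡y u u′∈⁅u⁆) hu′v

  matching-or-deficient : (∃ λ (f : Fin m → Fin n) → (∀ u → H u (f u) ≡ true) × Injective _≡_ _≡_ f)
                        ⊎ (∃ λ S → ∣ N S ∣ < ∣ S ∣)
  matching-or-deficient with anySubset? (λ S → ∣ N S ∣ ℕP.<? ∣ S ∣)
  ... | yes deficient = inj₂ deficient
  ... | no ∄deficient = inj₁ ((λ u → mate M ∈⊤) , (λ u → mate-edge M ∈⊤) , mate-injective M ∈⊤ ∈⊤)
    where
    hall⊤ : HallCondition ⊤ ⊤
    hall⊤ {S} _ rewrite ∩-identityʳ (N S) = ℕP.≮⇒≥ (λ deficient → ∄deficient (S , deficient))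
    M : Matching ⊤ ⊤
    M = hall (⊂-wellFounded ⊤) hall⊤

-- The Hungarian method

minimum : ∀ {n} → (Fin n → ℤ) → ℤ
minimum {zero}  f = + 0
minimum {suc n} f = f zero ℤ.⊓ minimum (f ∘ suc)

minimum≤ : ∀ {n} (f : Fin n → ℤ) i → minimum f ℤ.≤ f i
minimum≤ f zero    = ℤP.i⊓j≤i (f zero) _
minimum≤ f (suc i) = ℤP.≤-trans (ℤP.i⊓j≤j (f zero) _) (minimum≤ (f ∘ suc) i)

i≤j+∣i-j∣ : ∀ i j → i ℤ.≤ j ℤ.+ + ℤ.∣ i ℤ.- j ∣
i≤j+∣i-j∣ i j = subst (ℤ._≤ j ℤ.+ + ℤ.∣ i ℤ.- j ∣) (j+[i-j]≡i i j) (ℤP.+-monoʳ-≤ j (k≤∣k∣ (i ℤ.- j)))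
  where
  j+[i-j]≡i : ∀ i j → j ℤ.+ (i ℤ.- j) ≡ i
  j+[i-j]≡i = solve-∀
  k≤∣k∣ : ∀ k → k ℤ.≤ + ℤ.∣ k ∣
  k≤∣k∣ (+ _)      = ℤP.≤-refl
  k≤∣k∣ ℤ.-[1+ _ ] = ℤ.-≤+

module Hungarian {n} (E : EdgeSet n n) (w : Weight n n) where

  pricesℤ : (Fin n → ℤ) → (Fin n → ℤ) → Prices n n
  pricesℤ π p = prices (toℚ ∘ π) (toℚ ∘ p)

  Feasibleℤ : (Fin n → ℤ) → (Fin n → ℤ) → Set
  Feasibleℤ π p = ∀ u v → E u v ≡ true → π u ℤ.+ p v ℤ.≤ w u v

  dualℤ : (Fin n → ℤ) → (Fin n → ℤ) → ℤ
  dualℤ π p = Σℤ n π ℤ.+ Σℤ n p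

  Tight : (Fin n → ℤ) → (Fin n → ℤ) → EdgeSet n n
  Tight π p = Ecs E w (pricesℤ π p)

  feasible-pricesℤ : ∀ {π p} → Feasibleℤ π p → Feasible E w (pricesℤ π p)
  feasible-pricesℤ {π} {p} feasible u v uv∈E =
    subst (ℚ._≤ toℚ (w u v)) (toℚ-+ (π u) (p v)) (toℚ-mono-≤ (feasible u v uv∈E))

  dualValue-pricesℤ : ∀ π p → dualValue (pricesℤ π p) ≡ toℚ (dualℤ π p)
  dualValue-pricesℤ π p = sym (trans (toℚ-+ (Σℤ n π) (Σℤ n p)) (cong₂ ℚ._+_ (toℚ-Σ n π) (toℚ-Σ n p)))

  weakDualityℤ : ∀ {π p M} → Feasibleℤ π p → IsPerfectMatching E M → dualℤ π p ℤ.≤ weightOf w M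
  weakDualityℤ {π} {p} feasible pm = toℚ-cancel-≤
    (subst (ℚ._≤ _) (dualValue-pricesℤ π p) (weakDuality (feasible-pricesℤ {π} {p} feasible) pm))

  slack : ∀ {π p u v} → Feasibleℤ π p → E u v ≡ true → Tight π p u v ≢ true → π u ℤ.+ p v ℤ.< w u v
  slack {π} {p} {u} {v} feasible uv∈E uv∉Tight = ℤP.≤∧≢⇒< (feasible u v uv∈E) λ tight →
    uv∉Tight (Ecs⁺ {E = E} {w} {pricesℤ π p} uv∈E (trans (sym (toℚ-+ (π u) (p v))) (cong toℚ tight)))

  -- Raise π by 1 on S and lower p by 1 on N(S). Only edges from S to outside N(S) gain in
  -- π u + p v, and they are not tight, so their integral slack is at least 1.
  raise : ∀ {π p} → Feasibleℤ π p → (S : Subset n) → ∣ Hall.N (Tight π p) S ∣ < ∣ S ∣ →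
          ∃₂ λ π′ p′ → Feasibleℤ π′ p′ × dualℤ π p ℤ.< dualℤ π′ p′
  raise {π} {p} feasible S deficient = π′ , p′ , feasible′ , increase
    where
    open Hall (Tight π p) using (N; ∈N⁺)
    [S] [N] : Fin n → ℕ
    [S] u = if lookup S u then 1 else 0
    [N] v = if lookup (N S) v then 1 else 0
    π′ p′ : Fin n → ℤ
    π′ u = π u ℤ.+ + [S] u
    p′ v = p v ℤ.- + [N] v

    regroup : ∀ a b c d → (a ℤ.+ c) ℤ.+ (b ℤ.- d) ≡ (a ℤ.+ b) ℤ.+ (c ℤ.- d)
    regroup = solve-∀

    feasible′ : Feasibleℤ π′ p′
    feasible′ u v uv∈E rewrite regroup (π u) (p v) (+ [S] u) (+ [N] v)
      with lookup S u in u∈S | lookup (N S) v in v∈NS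
    ... | true  | true  = subst (ℤ._≤ w u v) (sym (ℤP.+-identityʳ _)) (feasible u v uv∈E)
    ... | false | false = subst (ℤ._≤ w u v) (sym (ℤP.+-identityʳ _)) (feasible u v uv∈E)
    ... | false | true  = ℤP.≤-trans (ℤP.i-j≤i _ (+ 1)) (feasible u v uv∈E)
    ... | true  | false =
      subst (ℤ._≤ w u v) (ℤP.+-comm (+ 1) (π u ℤ.+ p v))
        (ℤP.i<j⇒suc[i]≤j (slack {π} {p} feasible uv∈E uv∉Tight))
      where
      uv∉Tight : Tight π p u v ≢ true
      uv∉Tight uv∈Tight = Bool.not-¬ ([]=⇒lookup (∈N⁺ (lookup⇒[]= u S u∈S) uv∈Tight)) v∈NS

    Σπ′ : Σℤ n π′ ≡ Σℤ n π ℤ.+ + ∣ S ∣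
    Σπ′ = trans (Σℤ-+ n π _) (cong (ℤ._+_ (Σℤ n π)) (Σℤ-indicator S))

    Σp′ : Σℤ n p′ ℤ.+ + ∣ N S ∣ ≡ Σℤ n p
    Σp′ = begin
      Σℤ n p′ ℤ.+ + ∣ N S ∣               ≡⟨ cong (ℤ._+_ (Σℤ n p′)) (Σℤ-indicator (N S)) ⟨
      Σℤ n p′ ℤ.+ Σℤ n (λ v → + [N] v)    ≡⟨ Σℤ-+ n p′ _ ⟨
      Σℤ n (λ v → p′ v ℤ.+ + [N] v)       ≡⟨ Σℤ-cong n (λ v → [i-j]+j≡i (p v) (+ [N] v)) ⟩
      Σℤ n p                              ∎
      where
      open ≡-Reasoning
      [i-j]+j≡i : ∀ i j → (i ℤ.- j) ℤ.+ j ≡ i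
      [i-j]+j≡i = solve-∀

    balance : dualℤ π′ p′ ℤ.+ + ∣ N S ∣ ≡ dualℤ π p ℤ.+ + ∣ S ∣
    balance = begin
      (Σℤ n π′ ℤ.+ Σℤ n p′) ℤ.+ + ∣ N S ∣   ≡⟨ ℤP.+-assoc (Σℤ n π′) _ _ ⟩
      Σℤ n π′ ℤ.+ (Σℤ n p′ ℤ.+ + ∣ N S ∣)   ≡⟨ cong₂ ℤ._+_ Σπ′ Σp′ ⟩
      (Σℤ n π ℤ.+ + ∣ S ∣) ℤ.+ Σℤ n p       ≡⟨ swap (Σℤ n π) (+ ∣ S ∣) (Σℤ n p) ⟩
      (Σℤ n π ℤ.+ Σℤ n p) ℤ.+ + ∣ S ∣       ∎
      where
      open ≡-Reasoning
      swap : ∀ a b c → (a ℤ.+ b) ℤ.+ c ≡ (a ℤ.+ c) ℤ.+ b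
      swap = solve-∀

    increase : dualℤ π p ℤ.< dualℤ π′ p′
    increase = ℤP.≰⇒> λ dual′≤dual → ℤP.<-irrefl balance (ℤP.+-mono-≤-< dual′≤dual (ℤ.+<+ deficient))

  -- k bounds the number of remaining rounds: each raises the integral dual value by at least 1,
  -- and weak duality keeps it below the weight of M₀.
  hungarian : ∀ {M₀} → IsPerfectMatching E M₀ → ∀ k {π p} → Feasibleℤ π p →
              weightOf w M₀ ℤ.≤ dualℤ π p ℤ.+ + k →
              ∃ λ P → Feasible E w P × ∃ (IsPerfectMatching (Ecs E w P))
  hungarian pm₀ k {π} {p} feasible bound with Hall.matching-or-deficient (Tight π p)
  ... | inj₁ (f , edge , f-injective) =
    pricesℤ π p , feasible-pricesℤ {π} {p} feasible , graph f , injection⇒PM _ f edge f-injective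
  hungarian pm₀ zero {π} {p} feasible bound | inj₂ (S , deficient)
    with raise {π} {p} feasible S deficient
  ... | π′ , p′ , feasible′ , increase = ⊥-elim (ℤP.<-irrefl refl (begin-strict
    weightOf w _   ≤⟨ subst (weightOf w _ ℤ.≤_) (ℤP.+-identityʳ _) bound ⟩
    dualℤ π p      <⟨ increase ⟩
    dualℤ π′ p′    ≤⟨ weakDualityℤ feasible′ pm₀ ⟩
    weightOf w _   ∎))
    where open ℤP.≤-Reasoning
  hungarian pm₀ (suc k) {π} {p} feasible bound | inj₂ (S , deficient)
    with raise {π} {p} feasible S deficient
  ... | π′ , p′ , feasible′ , increase = hungarian pm₀ k feasible′ (begin
    weightOf w _                  ≤⟨ bound ⟩
    dualℤ π p ℤ.+ (+ 1 ℤ.+ + k)   ≡⟨ ℤP.+-assoc (dualℤ π p) (+ 1) (+ k) ⟨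
    (dualℤ π p ℤ.+ + 1) ℤ.+ + k   ≤⟨ ℤP.+-monoˡ-≤ (+ k) dual+1≤dual′ ⟩
    dualℤ π′ p′ ℤ.+ + k           ∎)
    where
    open ℤP.≤-Reasoning
    dual+1≤dual′ : dualℤ π p ℤ.+ + 1 ℤ.≤ dualℤ π′ p′
    dual+1≤dual′ = subst (ℤ._≤ dualℤ π′ p′) (ℤP.+-comm (+ 1) (dualℤ π p)) (ℤP.i<j⇒suc[i]≤j increase)

egervary : ∀ {n} (E : EdgeSet n n) (w : Weight n n) → ∃ (IsPerfectMatching E) →
           ∃ λ P → Feasible E w P × ∃ (IsPerfectMatching (Ecs E w P))
egervary {n} E w (M₀ , pm₀) = hungarian pm₀ _ feasible₀ (i≤j+∣i-j∣ (weightOf w M₀) (dualℤ π₀ p₀))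
  where
  open Hungarian E w
  π₀ p₀ : Fin n → ℤ
  π₀ u = minimum (w u)
  p₀ v = + 0
  feasible₀ : Feasibleℤ π₀ p₀
  feasible₀ u v _ = subst (ℤ._≤ w u v) (sym (ℤP.+-identityʳ _)) (minimum≤ (w u) v)

minWeightPM-exists : ∀ {n} (E : EdgeSet n n) (w : Weight n n) → ∃ (IsPerfectMatching E) →
                     ∃ (IsMinWeightPM E w)
minWeightPM-exists E w hasPM with egervary E w hasPM
... | P , feasible , M , pm = M , tightPM⇒minWeight {P = P} feasible pm

minWeight⇒tightPM : ∀ {n} {E : EdgeSet n n} {w : Weight n n} {P : Prices n n} →
                    IsOptimalPrices E w P → ∃ (IsPerfectMatching E) →
                    ∀ {M} → IsMinWeightPM E w M → IsPerfectMatching (Ecs E w P) M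
minWeight⇒tightPM {E = E} {w} {P} (feasible , optimal) hasPM {M} (pm , minimal) with egervary E w hasPM
... | Q , feasibleQ , M_Q , pm_Q = complementarySlackness feasible pm w≤dual , proj₂ pm
  where
  open ℚP.≤-Reasoning
  w≤dual : toℚ (weightOf w M) ℚ.≤ dualValue P
  w≤dual = begin
    toℚ (weightOf w M)     ≤⟨ toℚ-mono-≤ (minimal M_Q (PM-mono (Ecs⊆E {E = E} {w} {Q}) pm_Q)) ⟩
    toℚ (weightOf w M_Q)   ≡⟨ tightPM-weight {E = E} {w} {Q} pm_Q ⟩
    dualValue Q            ≤⟨ optimal Q feasibleQ ⟩
    dualValue P            ∎

mainTheorem10 : ∀ {m n : ℕ} (E : EdgeSet m n) (w : Weight m n) (P : Prices m n) (Ep : EdgeSet m n)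
    → (∃ λ M₀ → IsPerfectMatching E M₀)
    → IsOptimalPrices E w P
    → Ep ⊆E E
    → (∃ λ M → IsMinWeightPM (Ecs E w P) (wp Ep) M)
      × (∀ M → IsMinWeightPM (Ecs E w P) (wp Ep) M
           → IsMinWeightPM E w M
             × (∀ M′ → IsMinWeightPM E w M′ → card∩ M′ Ep ≤ card∩ M Ep))
mainTheorem10 E w P Ep hasPM@(_ , pm₀) optimal _ with PM⇒square pm₀
... | refl = minWeightPM-exists (Ecs E w P) (wp Ep) hasTightPM , λ M (pm , minimal) →
    tightPM⇒minWeight {P = P} (proj₁ optimal) pm ,
    λ M′ minWeight′@((_ , degU′≡1 , _) , _) →
      card∩-antitone Ep M M′ (proj₁ (proj₂ pm)) degU′≡1
        (minimal M′ (minWeight⇒tightPM optimal hasPM minWeight′))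
  where
  hasTightPM : ∃ (IsPerfectMatching (Ecs E w P))
  hasTightPM = let M , minWeight = minWeightPM-exists E w hasPM in
    M , minWeight⇒tightPM optimal hasPM minWeight
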